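{- Suppose $n\in \mathbb{N}$ and $1/n \ll \beta \ll \alpha, \gamma\leq 1$. Let $G$ be a $(\beta,\alpha)$-dense graph on $n$ vertices. If $U\subseteq V(G)$ with $|U|\geq \gamma n$, then $G[U]$ is a robust $(\alpha\beta,2\beta/\gamma)$-expander.
   Context: Hierarchy convention: there are non-decreasing functions $f,g$ such that the statement holds whenever $\beta\le f(\min\{\alpha,\gamma\})$ and $1/n\le g(\beta)$. For (not necessarily disjoint) $U,V\subseteq V(G)$ define $e_G(U,V):=e_G(U\setminus V,V)+e_G(V\setminus U,U\cap V)+2e(G[U\cap V])$ and $\mathrm{den}_G(U,V):=e_G(U,V)/(|U||V|)$; $G$ is $(\beta,\alpha)$-dense if $\mathrm{den}_G(U,V)\ge\alpha$ for all $U,V$ with $|U|,|V|\ge\beta|G|$. For $0<\nu\le\tau<1$, a graph $H$ on $m$ vertices and $S\subseteq V(H)$, the $\nu$-robust neighbourhood $RN_{\nu,H}(S)$ is the set of vertices of $H$ with at least $\nu m$ neighbours in $S$; $H$ is a robust $(\nu,\tau)$-expander if $|RN_{\nu,H}(S)|\ge |S|+\nu m$ for all $S\subseteq V(H)$ with $\tau m\le |S|\le (1-\tau)m$.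
   Formalization: The parameters α, β and γ are rational, and the non-decreasing functions f and g of the hierarchy convention are defined on ℚ and take values in ℚ. -}

module Defs where

open import Data.Bool using (Bool; true; false; if_then_else_)
open import Data.Nat as ℕ using (ℕ; NonZero)
open import Data.Fin using (Fin; toℕ)
open import Data.Fin.Subset using (Subset; _∈_; _⊆_; _∩_; _─_; ∣_∣)
open import Data.Fin.Subset.Properties using (_∈?_)
open import Data.Vec using (tabulate)
import Data.Vec as Vec
open import Data.Integer using (+_)
open import Data.Rational using (ℚ; _/_; _*_; _+_; _≤_)
open import Relation.Binary.PropositionalEquality using (_≡_)
open import Relation.Nullary.Decidable using (does)

[_]ℚ : ℕ → ℚ
[ k ]ℚ = + k / 1

record Graph (n : ℕ) : Set where
  field
    adj    : Fin n → Fin n → Bool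
    sym    : ∀ u v → adj u v ≡ adj v u
    irrefl : ∀ v → adj v v ≡ false
open Graph public

N : ∀ {n} → Graph n → Fin n → Subset n
N G v = tabulate (adj G v)

Σv : ∀ {n} → (Fin n → ℕ) → ℕ
Σv f = Vec.sum (tabulate f)

-- e_G(A,B): number of pairs (a,b), a ∈ A, b ∈ B, ab ∈ E(G)
-- (used for disjoint A, B, where it is the number of A–B edges)
eDisj : ∀ {n} → Graph n → Subset n → Subset n → ℕ
eDisj G A B = Σv (λ a → if does (a ∈? A) then ∣ B ∩ N G a ∣ else 0)

above : ∀ {n} → Fin n → Subset n
above i = tabulate (λ j → toℕ i ℕ.<ᵇ toℕ j)

eIn : ∀ {n} → Graph n → Subset n → ℕ
eIn G W = Σv (λ i → if does (i ∈? W) then ∣ W ∩ N G i ∩ above i ∣ else 0)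

eG : ∀ {n} → Graph n → Subset n → Subset n → ℕ
eG G U V = eDisj G (U ─ V) V ℕ.+ eDisj G (V ─ U) (U ∩ V) ℕ.+ 2 ℕ.* eIn G (U ∩ V)

-- den_G(U,V) ≥ α, written multiplicatively: e_G(U,V) ≥ α |U||V|
denAtLeast : ∀ {n} → Graph n → Subset n → Subset n → ℚ → Set
denAtLeast G U V α = α * [ ∣ U ∣ ]ℚ * [ ∣ V ∣ ]ℚ ≤ [ eG G U V ]ℚ

Dense : ∀ {n} → Graph n → ℚ → ℚ → Set
Dense {n} G β α = ∀ (U V : Subset n) →
  β * [ n ]ℚ ≤ [ ∣ U ∣ ]ℚ → β * [ n ]ℚ ≤ [ ∣ V ∣ ]ℚ → denAtLeast G U V α

RN : ∀ {n} → Graph n → Subset n → ℚ → Subset n → Subset n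
RN G W ν S = tabulate (λ v →
  does (v ∈? W) Data.Bool.∧ does (ν * [ ∣ W ∣ ]ℚ Data.Rational.≤? [ ∣ S ∩ N G v ∣ ]ℚ))

RobustExpander : ∀ {n} → Graph n → Subset n → ℚ → ℚ → Set
RobustExpander {n} G W ν τ = ∀ (S : Subset n) → S ⊆ W →
  τ * [ ∣ W ∣ ]ℚ ≤ [ ∣ S ∣ ]ℚ →
  [ ∣ S ∣ ]ℚ ≤ (1ℚ Data.Rational.- τ) * [ ∣ W ∣ ]ℚ →
  [ ∣ S ∣ ]ℚ + ν * [ ∣ W ∣ ]ℚ ≤ [ ∣ RN G W ν S ∣ ]ℚ
  where open Data.Rational using (1ℚ)

NonDecreasing : (ℚ → ℚ) → Set
NonDecreasing f = ∀ {x y} → x ≤ y → f x ≤ f y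

module Submission where

-- Let S ⊆ U with τ|U| ≤ |S| ≤ (1-τ)|U|, τ = 2β/γ, let R be the
-- αβ-robust neighbourhood of S in G[U] and D = U ─ R.  Every vertex of D has
-- fewer than αβ|U| neighbours in S, so e(D,S) ≤ |D|·αβ|U|.  If |R| were smaller
-- than |S| + αβ|U|, then |D| ≥ |U| - |R| > βn and |S| ≥ τ|U| ≥ 2βn, so density
-- gives e(D,S) ≥ α|D||S|; together |S| ≤ β|U| ≤ βn < 2βn ≤ |S|, a contradiction.
--
-- The theorem needs no smallness of β beyond
-- β > 0, so both hierarchy functions can be taken to be the identity.

module Counting where

  open import Defs hiding (sym)
  open import Data.Bool using (Bool; true; false; _∧_; not; if_then_else_)
  open import Data.Nat using (ℕ; zero; suc; _+_; _*_; _<ᵇ_)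
  open import Data.Nat.Properties
    using (+-assoc; +-comm; +-identityʳ; *-distribʳ-+; <ᵇ-reflects-<; <-asym; ≤-antisym; ≮⇒≥)
  open import Data.Fin using (Fin; toℕ) renaming (zero to fzero; suc to fsuc)
  open import Data.Fin.Properties using (toℕ-injective)
  open import Data.Fin.Subset using (Subset; _∩_; _─_; ∣_∣; inside; outside)
  open import Data.Fin.Subset.Properties using (_∈?_; ∩-comm)
  open import Data.Vec using ([]; _∷_; lookup)
  open import Data.Vec.Properties using (lookup∘tabulate; lookup-zipWith)
  open import Relation.Binary.PropositionalEquality
    using (_≡_; refl; sym; trans; cong; cong₂; module ≡-Reasoning)
  open import Relation.Nullary.Decidable using (does)
  open import Relation.Nullary.Reflects using (ofʸ; ofⁿ)
  open import Data.Empty using (⊥-elim)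

  χ : Bool → ℕ
  χ true  = 1
  χ false = 0

  χ-∧ : ∀ x y → χ (x ∧ y) ≡ χ x * χ y
  χ-∧ true  y = sym (+-identityʳ (χ y))
  χ-∧ false y = refl

  Σ-cong : ∀ {n} {f g : Fin n → ℕ} → (∀ i → f i ≡ g i) → Σv f ≡ Σv g
  Σ-cong {zero}  f≡g = refl
  Σ-cong {suc n} f≡g = cong₂ _+_ (f≡g fzero) (Σ-cong (λ i → f≡g (fsuc i)))

  Σ-zero : ∀ n → Σv {n} (λ _ → 0) ≡ 0
  Σ-zero zero    = refl
  Σ-zero (suc n) = Σ-zero n

  Σ-+ : ∀ {n} (f g : Fin n → ℕ) → Σv (λ i → f i + g i) ≡ Σv f + Σv g
  Σ-+ {zero}  f g = refl
  Σ-+ {suc n} f g = begin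
      (f fzero + g fzero) + Σv (λ i → f (fsuc i) + g (fsuc i))
    ≡⟨ cong ((f fzero + g fzero) +_) (Σ-+ (λ i → f (fsuc i)) (λ i → g (fsuc i))) ⟩
      (f fzero + g fzero) + (F + G)
    ≡⟨ +-assoc (f fzero) (g fzero) (F + G) ⟩
      f fzero + (g fzero + (F + G))
    ≡⟨ cong (f fzero +_) (sym (+-assoc (g fzero) F G)) ⟩
      f fzero + ((g fzero + F) + G)
    ≡⟨ cong (λ x → f fzero + (x + G)) (+-comm (g fzero) F) ⟩
      f fzero + ((F + g fzero) + G)
    ≡⟨ cong (f fzero +_) (+-assoc F (g fzero) G) ⟩
      f fzero + (F + (g fzero + G))
    ≡⟨ sym (+-assoc (f fzero) F (g fzero + G)) ⟩
      (f fzero + F) + (g fzero + G)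
    ∎
    where
    open ≡-Reasoning
    F = Σv (λ i → f (fsuc i))
    G = Σv (λ i → g (fsuc i))

  Σ-swap : ∀ {m n} (h : Fin m → Fin n → ℕ) →
    Σv (λ i → Σv (λ j → h i j)) ≡ Σv (λ j → Σv (λ i → h i j))
  Σ-swap {m} {zero}  h = Σ-zero m
  Σ-swap {m} {suc n} h = trans (Σ-+ (λ i → h i fzero) (λ i → Σv (λ j → h i (fsuc j))))
    (cong (Σv (λ i → h i fzero) +_) (Σ-swap (λ i j → h i (fsuc j))))

  ∈?-lookup : ∀ {n} (a : Fin n) (A : Subset n) → does (a ∈? A) ≡ lookup A a
  ∈?-lookup fzero    (inside  ∷ A) = refl
  ∈?-lookup fzero    (outside ∷ A) = refl
  ∈?-lookup (fsuc a) (_ ∷ A)       = ∈?-lookup a A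

  lookup-∩ : ∀ {n} (A B : Subset n) j → lookup (A ∩ B) j ≡ lookup A j ∧ lookup B j
  lookup-∩ A B j = lookup-zipWith _∧_ j A B

  lookup-─ : ∀ {n} (A B : Subset n) j → lookup (A ─ B) j ≡ lookup A j ∧ not (lookup B j)
  lookup-─ (true  ∷ A) (inside  ∷ B) fzero    = refl
  lookup-─ (false ∷ A) (inside  ∷ B) fzero    = refl
  lookup-─ (true  ∷ A) (outside ∷ B) fzero    = refl
  lookup-─ (false ∷ A) (outside ∷ B) fzero    = refl
  lookup-─ (_     ∷ A) (_       ∷ B) (fsuc j) = lookup-─ A B j

  card : ∀ {n} (A : Subset n) → ∣ A ∣ ≡ Σv (λ j → χ (lookup A j))
  card []            = refl
  card (inside  ∷ A) = cong suc (card A)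
  card (outside ∷ A) = card A

  χ-partition : ∀ {n} (A B : Subset n) j →
    χ (lookup (A ─ B) j) + χ (lookup (A ∩ B) j) ≡ χ (lookup A j)
  χ-partition A B j rewrite lookup-─ A B j | lookup-∩ A B j with lookup A j | lookup B j
  ... | true  | true  = refl
  ... | true  | false = refl
  ... | false | _     = refl

  card-partition : ∀ {n} (A B : Subset n) → ∣ A ─ B ∣ + ∣ A ∩ B ∣ ≡ ∣ A ∣
  card-partition A B = begin
    ∣ A ─ B ∣ + ∣ A ∩ B ∣
      ≡⟨ cong₂ _+_ (card (A ─ B)) (card (A ∩ B)) ⟩
    Σv (λ j → χ (lookup (A ─ B) j)) + Σv (λ j → χ (lookup (A ∩ B) j))
      ≡⟨ sym (Σ-+ (λ j → χ (lookup (A ─ B) j)) (λ j → χ (lookup (A ∩ B) j))) ⟩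
    Σv (λ j → χ (lookup (A ─ B) j) + χ (lookup (A ∩ B) j))
      ≡⟨ Σ-cong (χ-partition A B) ⟩
    Σv (λ j → χ (lookup A j))
      ≡⟨ sym (card A) ⟩
    ∣ A ∣ ∎
    where open ≡-Reasoning

  module _ {n : ℕ} (G : Graph n) where

    -- pairs p q counts the ordered pairs (a , b) of adjacent vertices with
    -- p a and q b; every edge count of the paper is an instance of it.
    pairs : (Fin n → Bool) → (Fin n → Bool) → ℕ
    pairs p q = Σv λ a → Σv λ b → χ (p a ∧ q b ∧ adj G a b)

    restrict-card : ∀ (A B : Subset n) a →
      (if does (a ∈? A) then ∣ B ∣ else 0) ≡ Σv (λ b → χ (lookup A a ∧ lookup B b))
    restrict-card A B a rewrite ∈?-lookup a A with lookup A a
    ... | true  = card B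
    ... | false = sym (Σ-zero n)

    eDisj≡pairs : ∀ A B → eDisj G A B ≡ pairs (lookup A) (lookup B)
    eDisj≡pairs A B = Σ-cong λ a → trans (restrict-card A (B ∩ N G a) a)
      (Σ-cong λ b → cong (λ x → χ (lookup A a ∧ x))
        (trans (lookup-∩ B (N G a) b) (cong (lookup B b ∧_) (lookup∘tabulate (adj G a) b))))

    pairs-sym : ∀ p q → pairs p q ≡ pairs q p
    pairs-sym p q = trans (Σ-swap (λ a b → χ (p a ∧ q b ∧ adj G a b))) (Σ-cong λ b → Σ-cong λ a → flip a b)
      where
      flip : ∀ a b → χ (p a ∧ q b ∧ adj G a b) ≡ χ (q b ∧ p a ∧ adj G b a)
      flip a b rewrite Graph.sym G b a with p a | q b
      ... | true  | true  = refl
      ... | true  | false = refl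
      ... | false | true  = refl
      ... | false | false = refl

    pairs-splitˡ : ∀ p₁ p₂ p q → (∀ a → χ (p₁ a) + χ (p₂ a) ≡ χ (p a)) →
      pairs p₁ q + pairs p₂ q ≡ pairs p q
    pairs-splitˡ p₁ p₂ p q split =
      trans (sym (Σ-+ (λ a → Σv (λ b → χ (p₁ a ∧ r a b))) (λ a → Σv (λ b → χ (p₂ a ∧ r a b)))))
        (Σ-cong λ a → trans (sym (Σ-+ (λ b → χ (p₁ a ∧ r a b)) (λ b → χ (p₂ a ∧ r a b))))
          (Σ-cong λ b → pointwise a (r a b)))
      where
      r : Fin n → Fin n → Bool
      r a b = q b ∧ adj G a b
      pointwise : ∀ a x → χ (p₁ a ∧ x) + χ (p₂ a ∧ x) ≡ χ (p a ∧ x)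
      pointwise a x = begin
        χ (p₁ a ∧ x) + χ (p₂ a ∧ x)     ≡⟨ cong₂ _+_ (χ-∧ (p₁ a) x) (χ-∧ (p₂ a) x) ⟩
        χ (p₁ a) * χ x + χ (p₂ a) * χ x ≡⟨ sym (*-distribʳ-+ (χ x) (χ (p₁ a)) (χ (p₂ a))) ⟩
        (χ (p₁ a) + χ (p₂ a)) * χ x     ≡⟨ cong (_* χ x) (split a) ⟩
        χ (p a) * χ x                   ≡⟨ sym (χ-∧ (p a) x) ⟩
        χ (p a ∧ x)                     ∎
        where open ≡-Reasoning

    pairs-splitʳ : ∀ p q₁ q₂ q → (∀ b → χ (q₁ b) + χ (q₂ b) ≡ χ (q b)) →
      pairs p q₁ + pairs p q₂ ≡ pairs p q
    pairs-splitʳ p q₁ q₂ q split =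
      trans (cong₂ _+_ (pairs-sym p q₁) (pairs-sym p q₂))
        (trans (pairs-splitˡ q₁ q₂ q p split) (pairs-sym q p))

    -- Of the two orientations of an edge ab exactly one is increasing
    -- (there are no loops, so a ≠ b).
    orientations : ∀ a b →
      χ (adj G a b ∧ (toℕ a <ᵇ toℕ b)) + χ (adj G b a ∧ (toℕ b <ᵇ toℕ a)) ≡ χ (adj G a b)
    orientations a b rewrite Graph.sym G b a
      with toℕ a <ᵇ toℕ b | <ᵇ-reflects-< (toℕ a) (toℕ b)
         | toℕ b <ᵇ toℕ a | <ᵇ-reflects-< (toℕ b) (toℕ a)
    ... | true  | ofʸ a<b | true  | ofʸ b<a = ⊥-elim (<-asym a<b b<a)
    ... | true  | _       | false | _       = one-orientation (adj G a b)
      where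
      one-orientation : ∀ x → χ (x ∧ true) + χ (x ∧ false) ≡ χ x
      one-orientation true  = refl
      one-orientation false = refl
    ... | false | _       | true  | _       = other-orientation (adj G a b)
      where
      other-orientation : ∀ x → χ (x ∧ false) + χ (x ∧ true) ≡ χ x
      other-orientation true  = refl
      other-orientation false = refl
    ... | false | ofⁿ a≮b | false | ofⁿ b≮a with toℕ-injective (≤-antisym (≮⇒≥ b≮a) (≮⇒≥ a≮b))
    ... | refl rewrite Graph.irrefl G a = refl

    eIn≡increasing : ∀ W → eIn G W ≡
      Σv (λ a → Σv (λ b → χ (lookup W a ∧ lookup W b ∧ adj G a b ∧ (toℕ a <ᵇ toℕ b))))
    eIn≡increasing W = Σ-cong λ a → trans (restrict-card W (W ∩ N G a ∩ above a) a)
      (Σ-cong λ b → cong (λ x → χ (lookup W a ∧ x))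
        (trans (lookup-∩ W (N G a ∩ above a) b) (cong (lookup W b ∧_)
          (trans (lookup-∩ (N G a) (above a) b)
            (cong₂ _∧_ (lookup∘tabulate (adj G a) b) (lookup∘tabulate (λ j → toℕ a <ᵇ toℕ j) b))))))

    double-eIn : ∀ W → 2 * eIn G W ≡ pairs (lookup W) (lookup W)
    double-eIn W = begin
      2 * eIn G W
        ≡⟨ cong (eIn G W +_) (+-identityʳ (eIn G W)) ⟩
      eIn G W + eIn G W
        ≡⟨ cong₂ _+_ (eIn≡increasing W) (trans (eIn≡increasing W) (Σ-swap inc)) ⟩
      Σv (λ a → Σv (λ b → inc a b)) + Σv (λ a → Σv (λ b → inc b a))
        ≡⟨ sym (Σ-+ (λ a → Σv (λ b → inc a b)) (λ a → Σv (λ b → inc b a))) ⟩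
      Σv (λ a → Σv (λ b → inc a b) + Σv (λ b → inc b a))
        ≡⟨ Σ-cong (λ a → sym (Σ-+ (λ b → inc a b) (λ b → inc b a))) ⟩
      Σv (λ a → Σv (λ b → inc a b + inc b a))
        ≡⟨ Σ-cong (λ a → Σ-cong (both a)) ⟩
      pairs (lookup W) (lookup W) ∎
      where
      open ≡-Reasoning
      inc : Fin n → Fin n → ℕ
      inc a b = χ (lookup W a ∧ lookup W b ∧ adj G a b ∧ (toℕ a <ᵇ toℕ b))
      both : ∀ a b → inc a b + inc b a ≡ χ (lookup W a ∧ lookup W b ∧ adj G a b)
      both a b with lookup W a | lookup W b
      ... | true  | true  = orientations a b
      ... | true  | false = refl
      ... | false | true  = refl
      ... | false | false = refl

    -- The paper's e_G(U,V) for overlapping U, V equals eDisj G U V: both count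
    -- the ordered adjacent pairs in U × V.
    eG≡eDisj : ∀ U V → eG G U V ≡ eDisj G U V
    eG≡eDisj U V = begin
      eDisj G (U ─ V) V + eDisj G (V ─ U) (U ∩ V) + 2 * eIn G (U ∩ V)
        ≡⟨ cong₂ _+_ (cong₂ _+_ (eDisj≡pairs (U ─ V) V)
                                (trans (eDisj≡pairs (V ─ U) (U ∩ V)) (pairs-sym [V─U] [U∩V])))
                     (double-eIn (U ∩ V)) ⟩
      pairs [U─V] [V] + pairs [U∩V] [V─U] + pairs [U∩V] [U∩V]
        ≡⟨ +-assoc (pairs [U─V] [V]) (pairs [U∩V] [V─U]) (pairs [U∩V] [U∩V]) ⟩
      pairs [U─V] [V] + (pairs [U∩V] [V─U] + pairs [U∩V] [U∩V])
        ≡⟨ cong (pairs [U─V] [V] +_) (pairs-splitʳ [U∩V] [V─U] [U∩V] [V] V-partition) ⟩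
      pairs [U─V] [V] + pairs [U∩V] [V]
        ≡⟨ pairs-splitˡ [U─V] [U∩V] (lookup U) [V] (χ-partition U V) ⟩
      pairs (lookup U) [V]
        ≡⟨ sym (eDisj≡pairs U V) ⟩
      eDisj G U V ∎
      where
      open ≡-Reasoning
      [U─V] = lookup (U ─ V)
      [V─U] = lookup (V ─ U)
      [U∩V] = lookup (U ∩ V)
      [V]   = lookup V
      V-partition : ∀ b → χ ([V─U] b) + χ ([U∩V] b) ≡ χ ([V] b)
      V-partition b rewrite ∩-comm U V = χ-partition V U b

module Arithmetic where

  open import Defs using ([_]ℚ)
  open import Data.Nat as ℕ using ()
  import Data.Nat.Properties as ℕₚ
  open import Data.Nat.Coprimality using (1-coprimeTo; sym)
  open import Data.Integer as ℤ using (+_)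
  import Data.Integer.Properties as ℤₚ
  open import Data.Rational
  open import Data.Rational.Properties
  open import Data.Rational.Solver using (module +-*-Solver)
  import Data.Rational.Unnormalised as ℚᵘ
  import Data.Rational.Unnormalised.Properties as ℚᵘₚ
  open import Relation.Binary.PropositionalEquality
    using (_≡_; refl; trans; cong; cong₂; subst; subst₂) renaming (sym to ≡-sym)
  open import Relation.Nullary using (¬_)

  []-normal : ∀ k → [ k ]ℚ ≡ mkℚ (+ k) 0 (sym (1-coprimeTo k))
  []-normal k = normalize-coprime (sym (1-coprimeTo k))

  [+] : ∀ a b → [ a ℕ.+ b ]ℚ ≡ [ a ]ℚ + [ b ]ℚ
  [+] a b = toℚᵘ-injective (ℚᵘₚ.≃-trans sum (ℚᵘₚ.≃-sym (toℚᵘ-homo-+ [ a ]ℚ [ b ]ℚ)))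
    where
    sum : toℚᵘ [ a ℕ.+ b ]ℚ ℚᵘ.≃ toℚᵘ [ a ]ℚ ℚᵘ.+ toℚᵘ [ b ]ℚ
    sum rewrite []-normal a | []-normal b | []-normal (a ℕ.+ b) =
      ℚᵘ.*≡* (cong (ℤ._* + 1) (trans
        (cong₂ (λ x y → + (x ℕ.+ y)) (≡-sym (ℕₚ.*-identityʳ a)) (≡-sym (ℕₚ.*-identityʳ b)))
        (≡-sym (cong₂ ℤ._+_ (ℤₚ.+◃n≡+n (a ℕ.* 1)) (ℤₚ.+◃n≡+n (b ℕ.* 1))))))

  [≤] : ∀ {a b} → a ℕ.≤ b → [ a ]ℚ ≤ [ b ]ℚ
  [≤] {a} {b} a≤b rewrite []-normal a | []-normal b =
    *≤* (subst₂ ℤ._≤_ (≡-sym (ℤₚ.*-identityʳ (+ a))) (≡-sym (ℤₚ.*-identityʳ (+ b))) (ℤ.+≤+ a≤b))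

  open +-*-Solver

  +-cancelʳ-< : ∀ r {p q} → p + r < q + r → p < q
  +-cancelʳ-< r {p} {q} p+r<q+r = subst₂ _<_ (cancel p) (cancel q) (+-monoˡ-< (- r) p+r<q+r)
    where
    cancel : ∀ x → x + r + - r ≡ x
    cancel x = solve 2 (λ x r → x :+ r :+ :- r := x) refl x r

  <-double : ∀ {b} → 0ℚ < b → b < b + b
  <-double {b} 0<b = subst (_< b + b) (+-identityʳ b) (+-monoʳ-< b 0<b)

  τ-lower : ∀ β γ {n m} .{{_ : NonZero γ}} → 0ℚ ≤ β → 0ℚ < γ → γ * n ≤ m →
    β * n + β * n ≤ (+ 2 / 1) * β ÷ γ * m
  τ-lower β γ {n} {m} 0≤β 0<γ γn≤m = begin
    β * n + β * n
      ≡⟨ solve 2 (λ β n → β :* n :+ β :* n := con (+ 2 / 1) :* β :* n :* con 1ℚ) refl β n ⟩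
    (+ 2 / 1) * β * n * 1ℚ
      ≡⟨ cong ((+ 2 / 1) * β * n *_) (≡-sym (*-inverseˡ γ)) ⟩
    (+ 2 / 1) * β * n * (1/ γ * γ)
      ≡⟨ solve 4 (λ β n γ γ⁻¹ → con (+ 2 / 1) :* β :* n :* (γ⁻¹ :* γ)
                              := con (+ 2 / 1) :* β :* γ⁻¹ :* (γ :* n)) refl β n γ (1/ γ) ⟩
    τ * (γ * n)
      ≤⟨ *-monoˡ-≤-nonNeg τ γn≤m ⟩
    τ * m ∎
    where
    open ≤-Reasoning
    τ = (+ 2 / 1) * β ÷ γ
    instance
      γ-pos : Positive γ
      γ-pos = positive 0<γ
      γ⁻¹-pos : Positive (1/ γ)
      γ⁻¹-pos = 1/pos⇒pos γ
      2β-nonNeg : NonNegative ((+ 2 / 1) * β)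
      2β-nonNeg = nonNeg*nonNeg⇒nonNeg (+ 2 / 1) β {{nonNegative 0≤β}}
      τ-nonNeg : NonNegative τ
      τ-nonNeg = nonNeg*nonNeg⇒nonNeg ((+ 2 / 1) * β) (1/ γ) {{pos⇒nonNeg (1/ γ)}}

  upper-threshold : ∀ {τ m s} → s ≤ (1ℚ - τ) * m → τ * m + s ≤ m
  upper-threshold {τ} {m} {s} s≤ = begin
    τ * m + s              ≤⟨ +-monoʳ-≤ (τ * m) s≤ ⟩
    τ * m + (1ℚ - τ) * m   ≡⟨ solve 2 (λ τ m → τ :* m :+ (con 1ℚ :- τ) :* m := m) refl τ m ⟩
    m                      ∎
    where open ≤-Reasoning

  ν-upper : ∀ {α β m n} → α ≤ 1ℚ → 0ℚ ≤ β → 0ℚ ≤ m → m ≤ n → α * β * m ≤ β * n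
  ν-upper {α} {β} {m} {n} α≤1 0≤β 0≤m m≤n = begin
    α * β * m     ≡⟨ *-assoc α β m ⟩
    α * (β * m)   ≤⟨ *-monoʳ-≤-nonNeg (β * m) α≤1 ⟩
    1ℚ * (β * m)  ≡⟨ *-identityˡ (β * m) ⟩
    β * m         ≤⟨ *-monoˡ-≤-nonNeg β m≤n ⟩
    β * n         ∎
    where
    open ≤-Reasoning
    instance
      β-nonNeg : NonNegative β
      β-nonNeg = nonNegative 0≤β
      βm-nonNeg : NonNegative (β * m)
      βm-nonNeg = nonNeg*nonNeg⇒nonNeg β m {{nonNegative 0≤m}}

  -- If the robust neighbourhood R is small, |R| < |S| + ν|U|, then its complement
  -- D in U is large:  b + |R| < b + |S| + ν|U| ≤ 2b + |S| ≤ τ|U| + |S| ≤ |U| ≤ |R| + |D|.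
  complement-large : ∀ {b τm s νm m r d} →
    νm ≤ b → b + b ≤ τm → τm + s ≤ m → m ≤ r + d → r < s + νm → b < d
  complement-large {b} {τm} {s} {νm} {m} {r} {d} νm≤b 2b≤τm τm+s≤m m≤r+d r<s+νm =
    +-cancelʳ-< r (begin-strict
      b + r         <⟨ +-monoʳ-< b r<s+νm ⟩
      b + (s + νm)  ≤⟨ +-monoʳ-≤ b (+-monoʳ-≤ s νm≤b) ⟩
      b + (s + b)   ≡⟨ solve 2 (λ b s → b :+ (s :+ b) := b :+ b :+ s) refl b s ⟩
      b + b + s     ≤⟨ +-monoˡ-≤ s 2b≤τm ⟩
      τm + s        ≤⟨ τm+s≤m ⟩
      m             ≤⟨ m≤r+d ⟩
      r + d         ≡⟨ +-comm r d ⟩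
      d + r         ∎)
    where open ≤-Reasoning

  -- Cancelling α|D| > 0 in  α|D||S| ≤ e(D,S) ≤ |D|·αβ|U|  gives |S| ≤ β|U|.
  density-cancel : ∀ {α β m d s} → 0ℚ < α → 0ℚ < d →
    α * d * s ≤ d * (α * β * m) → s ≤ β * m
  density-cancel {α} {β} {m} {d} {s} 0<α 0<d αds≤ =
    *-cancelˡ-≤-pos (α * d) {{pos*pos⇒pos α {{positive 0<α}} d {{positive 0<d}}}}
      (subst (α * d * s ≤_)
        (solve 4 (λ α β m d → d :* (α :* β :* m) := α :* d :* (β :* m)) refl α β m d) αds≤)

  -- Here m, s, r, d stand for |U|,
  -- |S|, |R|, |U ─ R| and e for the number of edges from U ─ R to S.  If
  -- |R| < |S| + αβ|U|, then U ─ R and S are both larger than βn, so density and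
  -- the degree bound force |S| ≤ β|U| ≤ βn < 2βn ≤ τ|U| ≤ |S|.
  expansion-inequality : ∀ (α β γ n m s r d e : ℚ) .{{_ : NonZero γ}} →
    0ℚ < α → α ≤ 1ℚ → 0ℚ < β → 0ℚ < γ → 0ℚ < n → γ * n ≤ m → m ≤ n →
    (+ 2 / 1) * β ÷ γ * m ≤ s → s ≤ (1ℚ - (+ 2 / 1) * β ÷ γ) * m → m ≤ r + d →
    (β * n ≤ d → β * n ≤ s → α * d * s ≤ e) → e ≤ d * (α * β * m) →
    s + α * β * m ≤ r
  expansion-inequality α β γ n m s r d e 0<α α≤1 0<β 0<γ 0<n γn≤m m≤n
                       τm≤s s≤ m≤r+d dense e≤ = ≮⇒≥ small-R-impossible
    where
    0<βn : 0ℚ < β * n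
    0<βn = positive⁻¹ (β * n) {{pos*pos⇒pos β {{positive 0<β}} n {{positive 0<n}}}}
    0≤m : 0ℚ ≤ m
    0≤m = ≤-trans (nonNegative⁻¹ (γ * n) {{pos⇒nonNeg (γ * n)
            {{pos*pos⇒pos γ {{positive 0<γ}} n {{positive 0<n}}}}}}) γn≤m
    2βn≤s : β * n + β * n ≤ s
    2βn≤s = ≤-trans (τ-lower β γ (<⇒≤ 0<β) 0<γ γn≤m) τm≤s
    small-R-impossible : ¬ (r < s + α * β * m)
    small-R-impossible r<s+νm = <-irrefl refl (begin-strict
        β * n          <⟨ <-double 0<βn ⟩
        β * n + β * n  ≤⟨ 2βn≤s ⟩
        s              ≤⟨ density-cancel 0<α (<-trans 0<βn βn<d) (≤-trans (dense (<⇒≤ βn<d) βn≤s) e≤) ⟩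
        β * m          ≤⟨ *-monoˡ-≤-nonNeg β {{nonNegative (<⇒≤ 0<β)}} m≤n ⟩
        β * n          ∎)
      where
      open ≤-Reasoning
      βn<d : β * n < d
      βn<d = complement-large (ν-upper α≤1 (<⇒≤ 0<β) 0≤m m≤n)
               (τ-lower β γ (<⇒≤ 0<β) 0<γ γn≤m) (upper-threshold {(+ 2 / 1) * β ÷ γ} s≤)
               m≤r+d r<s+νm
      βn≤s : β * n ≤ s
      βn≤s = ≤-trans (<⇒≤ (<-double 0<βn)) 2βn≤s

open import Defs hiding (sym)
open import Data.Bool using (true; false; _∧_; not; if_then_else_)
open import Data.Nat as ℕ using (ℕ)
import Data.Nat.Properties as ℕₚ
open import Data.Fin using (Fin) renaming (zero to fzero; suc to fsuc)
open import Data.Fin.Subset using (Subset; _∈_; _∩_; _─_; ∣_∣; inside; outside)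
open import Data.Fin.Subset.Properties using (_∈?_; ∣p∣≤n; ∣p∩q∣≤∣q∣)
open import Data.Vec using ([]; _∷_; lookup; here; there)
open import Data.Vec.Properties using (lookup∘tabulate; []=⇒lookup)
open import Data.Integer using (+_)
open import Data.Rational
  using (ℚ; NonZero; 0ℚ; 1ℚ; _/_; _*_; _÷_; _⊓_; _+_; _≤_; _<_; _≤?_; positive)
open import Data.Rational.Properties
  using (≤-reflexive; +-mono-≤; *-zeroˡ; *-identityˡ; *-distribʳ-+; ≰⇒>; <⇒≤;
         module ≤-Reasoning; normalize-pos; normalize-nonNeg; pos*pos⇒pos;
         nonNeg*nonNeg⇒nonNeg; pos⇒nonNeg; positive⁻¹; nonNegative⁻¹)
open import Data.Product using (Σ; _×_; _,_)
open import Function using (id)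
open import Relation.Binary.PropositionalEquality
  using (_≡_; refl; sym; trans; cong; subst)
open import Relation.Nullary using (¬_)
open import Relation.Nullary.Decidable using (does; dec-true)

open Counting using (∈?-lookup; lookup-─; eG≡eDisj; card-partition)
open Arithmetic using ([+]; [≤]; expansion-inequality)

Σ-over-subset-≤ : ∀ {n} (A : Subset n) (f : Fin n → ℕ) {c : ℚ} → 0ℚ ≤ c →
  (∀ {a} → a ∈ A → [ f a ]ℚ ≤ c) →
  [ Σv (λ a → if does (a ∈? A) then f a else 0) ]ℚ ≤ [ ∣ A ∣ ]ℚ * c
Σ-over-subset-≤ []            f {c} 0≤c bound = ≤-reflexive (sym (*-zeroˡ c))
Σ-over-subset-≤ (outside ∷ A) f     0≤c bound =
  Σ-over-subset-≤ A (λ a → f (fsuc a)) 0≤c (λ a∈A → bound (there a∈A))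
Σ-over-subset-≤ (inside ∷ A)  f {c} 0≤c bound = begin
  [ f fzero ℕ.+ rest ]ℚ            ≡⟨ [+] (f fzero) rest ⟩
  [ f fzero ]ℚ + [ rest ]ℚ         ≤⟨ +-mono-≤ (bound here)
                                        (Σ-over-subset-≤ A (λ a → f (fsuc a)) 0≤c (λ a∈A → bound (there a∈A))) ⟩
  c + [ ∣ A ∣ ]ℚ * c               ≡⟨ cong (_+ [ ∣ A ∣ ]ℚ * c) (sym (*-identityˡ c)) ⟩
  1ℚ * c + [ ∣ A ∣ ]ℚ * c          ≡⟨ sym (*-distribʳ-+ c 1ℚ [ ∣ A ∣ ]ℚ) ⟩
  (1ℚ + [ ∣ A ∣ ]ℚ) * c            ≡⟨ cong (_* c) (sym ([+] 1 ∣ A ∣)) ⟩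
  [ ℕ.suc ∣ A ∣ ]ℚ * c             ∎
  where
  open ≤-Reasoning
  rest = Σv (λ a → if does (a ∈? A) then f (fsuc a) else 0)

outside-RN-degree : ∀ {n} (G : Graph n) (U S : Subset n) (ν : ℚ) {t} →
  t ∈ U ─ RN G U ν S → [ ∣ S ∩ N G t ∣ ]ℚ ≤ ν * [ ∣ U ∣ ]ℚ
outside-RN-degree G U S ν {t} t∈D = <⇒≤ (≰⇒> not-robust)
  where
  robust? = ν * [ ∣ U ∣ ]ℚ ≤? [ ∣ S ∩ N G t ∣ ]ℚ
  lookup-RN : lookup (RN G U ν S) t ≡ lookup U t ∧ does robust?
  lookup-RN = trans (lookup∘tabulate _ t) (cong (_∧ does robust?) (∈?-lookup t U))
  in-D : lookup U t ∧ not (lookup U t ∧ does robust?) ≡ true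
  in-D = trans (cong (λ x → lookup U t ∧ not x) (sym lookup-RN))
           (trans (sym (lookup-─ U (RN G U ν S) t)) ([]=⇒lookup t∈D))
  excluded : ∀ u b → u ∧ not (u ∧ b) ≡ true → b ≡ false
  excluded true  false _  = refl
  excluded true  true  ()
  excluded false _     ()
  not-robust : ¬ (ν * [ ∣ U ∣ ]ℚ ≤ [ ∣ S ∩ N G t ∣ ]ℚ)
  not-robust robust with trans (sym (dec-true robust? robust)) (excluded (lookup U t) _ in-D)
  ... | ()

-- The proposition, with the hierarchy constraints replaced by what the
-- argument actually uses: β > 0 and α ≤ 1.
dense⇒robust-expander : ∀ {n} .{{_ : ℕ.NonZero n}} (α β γ : ℚ) .{{_ : NonZero γ}} →
  0ℚ < α → α ≤ 1ℚ → 0ℚ < β → 0ℚ < γ →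
  (G : Graph n) → Dense G β α →
  (U : Subset n) → γ * [ n ]ℚ ≤ [ ∣ U ∣ ]ℚ →
  RobustExpander G U (α * β) ((+ 2 / 1) * β ÷ γ)
dense⇒robust-expander {n} α β γ 0<α α≤1 0<β 0<γ G dense U U-large S _ S-large S-small =
  expansion-inequality α β γ [ n ]ℚ [ ∣ U ∣ ]ℚ [ ∣ S ∣ ]ℚ [ ∣ R ∣ ]ℚ [ ∣ D ∣ ]ℚ [ eDisj G D S ]ℚ
    0<α α≤1 0<β 0<γ 0<n U-large ([≤] (∣p∣≤n U)) S-large S-small U-covered D-S-dense D-S-sparse
  where
  ν = α * β
  R = RN G U ν S
  D = U ─ R
  0<n : 0ℚ < [ n ]ℚ
  0<n = positive⁻¹ [ n ]ℚ {{normalize-pos n 1}}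
  U-covered : [ ∣ U ∣ ]ℚ ≤ [ ∣ R ∣ ]ℚ + [ ∣ D ∣ ]ℚ
  U-covered = subst ([ ∣ U ∣ ]ℚ ≤_) ([+] ∣ R ∣ ∣ D ∣) ([≤] (begin
    ∣ U ∣                ≡⟨ sym (card-partition U R) ⟩
    ∣ D ∣ ℕ.+ ∣ U ∩ R ∣  ≤⟨ ℕₚ.+-monoʳ-≤ ∣ D ∣ (∣p∩q∣≤∣q∣ U R) ⟩
    ∣ D ∣ ℕ.+ ∣ R ∣      ≡⟨ ℕₚ.+-comm ∣ D ∣ ∣ R ∣ ⟩
    ∣ R ∣ ℕ.+ ∣ D ∣      ∎))
    where open ℕₚ.≤-Reasoning
  D-S-dense : β * [ n ]ℚ ≤ [ ∣ D ∣ ]ℚ → β * [ n ]ℚ ≤ [ ∣ S ∣ ]ℚ →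
    α * [ ∣ D ∣ ]ℚ * [ ∣ S ∣ ]ℚ ≤ [ eDisj G D S ]ℚ
  D-S-dense βn≤D βn≤S =
    subst (λ k → α * [ ∣ D ∣ ]ℚ * [ ∣ S ∣ ]ℚ ≤ [ k ]ℚ) (eG≡eDisj G D S) (dense D S βn≤D βn≤S)
  D-S-sparse : [ eDisj G D S ]ℚ ≤ [ ∣ D ∣ ]ℚ * (ν * [ ∣ U ∣ ]ℚ)
  D-S-sparse = Σ-over-subset-≤ D (λ t → ∣ S ∩ N G t ∣) 0≤ν|U| (outside-RN-degree G U S ν)
    where
    0≤ν|U| : 0ℚ ≤ ν * [ ∣ U ∣ ]ℚ
    0≤ν|U| = nonNegative⁻¹ (ν * [ ∣ U ∣ ]ℚ)
      {{nonNeg*nonNeg⇒nonNeg ν {{pos⇒nonNeg ν {{pos*pos⇒pos α {{positive 0<α}} β {{positive 0<β}}}}}}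
                            [ ∣ U ∣ ]ℚ {{normalize-nonNeg ∣ U ∣ 1}}}}

proposition4p3 : Σ (ℚ → ℚ) λ f → Σ (ℚ → ℚ) λ g →
    NonDecreasing f × NonDecreasing g ×
    (∀ x → 0ℚ < x → 0ℚ < f x) × (∀ x → 0ℚ < x → 0ℚ < g x) ×
    (∀ (n : ℕ) .{{_ : ℕ.NonZero n}} (α β γ : ℚ) .{{_ : NonZero γ}} →
    0ℚ < α → α ≤ 1ℚ → 0ℚ < γ → γ ≤ 1ℚ → 0ℚ < β →
    β ≤ f (α ⊓ γ) → + 1 / n ≤ g β →
    (G : Graph n) → Dense G β α →
    (U : Subset n) → γ * [ n ]ℚ ≤ [ ∣ U ∣ ]ℚ →
    RobustExpander G U (α * β) ((+ 2 / 1) * β ÷ γ))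
proposition4p3 = id , id , (λ x≤y → x≤y) , (λ x≤y → x≤y) , (λ _ 0<x → 0<x) , (λ _ 0<x → 0<x) ,
  λ n α β γ 0<α α≤1 0<γ _ 0<β _ _ G dense U U-large →
    dense⇒robust-expander α β γ 0<α α≤1 0<β 0<γ G dense U U-large
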